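{- For positive integers $m,n$, $RR(A_m,A_n)=N_{m,n}$, where $N_{m,n}$ is the minimum integer $N$ such that $\binom{N}{\lfloor N/2\rfloor}\ge (m-1)(n-1)+1$.
   Context: For a positive integer $N$, $\mathcal{B}_N$ denotes the Boolean lattice of all subsets of $[N]=\{1,\dots,N\}$ ordered by inclusion. A family $\mathcal{G}$ of sets is a copy of a poset $P$ if there is a bijection $\phi:P\to\mathcal{G}$ with $x<_P y$ if and only if $\phi(x)\subsetneq\phi(y)$. A coloring of $\mathcal{B}_N$ is any map from $\mathcal{B}_N$ to the positive integers. Under a coloring, a monochromatic $P$ is a copy of $P$ all of whose sets have the same color, and a rainbow $Q$ is a copy of $Q$ whose sets have pairwise distinct colors. $RR(P,Q)$ is the minimum integer $N$ such that every coloring of $\mathcal{B}_N$ contains a monochromatic $P$ or a rainbow $Q$. $A_k$ denotes the antichain with $k$ elements (no two elements comparable). -}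

module Defs where

open import Data.Nat using (ℕ; _≤_; _<_; _+_; _*_; _∸_; _/_)
open import Data.Nat.Combinatorics using (_C_)
open import Data.Fin using (Fin)
open import Data.Fin.Subset using (Subset; _⊂_)
open import Data.Product using (Σ; _×_)
open import Data.Sum using (_⊎_)
open import Relation.Nullary using (¬_)
open import Relation.Binary.PropositionalEquality using (_≡_; _≢_)
open import Function.Definitions using (Injective)

-- The Boolean lattice B_N: subsets of Fin N (= [N]), ordered by inclusion.
-- A coloring of B_N: any map to colors; colors are ℕ (read c as color c+1).
Coloring : ℕ → Set
Coloring N = Subset N → ℕ

-- A copy of the antichain A_k in B_N: an injective map φ : Fin k → B_N
-- such that no φ i is a proper subset of φ j (since A_k has no relations).
IsAntichainCopy : {N k : ℕ} → (Fin k → Subset N) → Set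
IsAntichainCopy φ = Injective _≡_ _≡_ φ × (∀ i j → ¬ (φ i ⊂ φ j))

MonoA : {N : ℕ} → ℕ → Coloring N → Set
MonoA {N} k c = Σ (Fin k → Subset N) λ φ → IsAntichainCopy φ × (∀ i j → c (φ i) ≡ c (φ j))

RainbowA : {N : ℕ} → ℕ → Coloring N → Set
RainbowA {N} k c = Σ (Fin k → Subset N) λ φ → IsAntichainCopy φ × (∀ i j → i ≢ j → c (φ i) ≢ c (φ j))

ArrowsAA : ℕ → ℕ → ℕ → Set
ArrowsAA m n N = (c : Coloring N) → MonoA m c ⊎ RainbowA n c

IsMinimum : (ℕ → Set) → ℕ → Set
IsMinimum P N = P N × (∀ M → M < N → ¬ P M)

RRAntichainsIs : ℕ → ℕ → ℕ → Set
RRAntichainsIs m n N = IsMinimum (ArrowsAA m n) N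

NmnIs : ℕ → ℕ → ℕ → Set
NmnIs m n N = IsMinimum (λ M → (m ∸ 1) * (n ∸ 1) + 1 ≤ M C (M / 2)) N

-- The middle layer of B_N is an antichain with C(N,⌊N/2⌋) elements.  If this
-- exceeds (m-1)(n-1), every coloring either repeats a color m times on it or
-- uses n colors on it.  Conversely, B_N is partitioned into C(N,⌊N/2⌋) chains
-- (the symmetric chain decomposition given by bracket matching).  If
-- C(N,⌊N/2⌋) ≤ (m-1)(n-1), coloring chain number κ with ⌊κ/(m-1)⌋ uses at most
-- n-1 colors and covers each color class by m-1 chains; as an antichain meets
-- every chain at most once, there is neither a monochromatic A_m nor a
-- rainbow A_n.
module Submission where

open import Defs
open import Data.Nat
  using (ℕ; zero; suc; pred; _+_; _*_; _/_; _%_; _≤_; _<_; z≤n; s≤s; _≤?_; _≟_; NonZero)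
open import Data.Nat.Properties
open import Data.Nat.DivMod
  using (m≡m%n+[m/n]*n; m%n<n; m<n*o⇒m/o<n; m/n≤m; m*n/n≡m; +-distrib-/-∣ˡ)
open import Data.Nat.Divisibility using (n∣m*n)
open import Data.Nat.Combinatorics using (_C_; nCk+nC[k+1]≡[n+1]C[k+1])
open import Data.Vec using (Vec; []; _∷_)
open import Data.Vec.Properties using (∷-injectiveʳ)
open import Data.Vec.Functional using () renaming (_∷_ to _∷ᶠ_)
open import Data.Fin using (Fin; toℕ; fromℕ<) renaming (zero to fzero; suc to fsuc)
import Data.Fin.Properties as Fin
open import Data.Fin.Subset using (Subset; inside; outside; _⊆_; _⊂_; ∣_∣) renaming (⊥ to ∅)
open import Data.Fin.Subset.Properties
  using (⊆-refl; s⊆s; out⊆; s⊂s; out⊂in; drop-∷-⊆; p⊂q⇒∣p∣<∣q∣)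
open import Data.List using (List; []; _∷_; length; map; _++_; filter; lookup)
open import Data.List.Properties using (length-map; length-++)
open import Data.List.Membership.Propositional using (_∈_)
open import Data.List.Membership.Propositional.Properties
  using (∈-map⁺; ∈-map⁻; ∈-++⁺ˡ; ∈-++⁺ʳ; ∈-++⁻; ∈-filter⁻)
open import Data.List.Relation.Unary.Any using (here; there; index)
open import Data.List.Relation.Unary.Any.Properties using (lookup-index)
open import Data.List.Relation.Unary.All as All using ([])
open import Data.List.Relation.Unary.AllPairs using ([]; _∷_)
open import Data.List.Relation.Unary.Unique.Propositional using (Unique)
import Data.List.Relation.Unary.Unique.Propositional.Properties as Unique
open import Data.Product using (Σ; ∃₂; _×_; _,_; proj₁; proj₂)
open import Data.Sum using (_⊎_; inj₁; inj₂; [_,_]′)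
open import Function using (_∘_)
open import Function.Definitions using (Injective)
open import Relation.Nullary using (¬_; Dec; yes; no; contradiction)
open import Relation.Nullary.Decidable using (¬?)
open import Relation.Binary.PropositionalEquality

private variable
  n k : ℕ

⊆∧≢⇒⊂ : {p q : Subset n} → p ⊆ q → p ≢ q → p ⊂ q
⊆∧≢⇒⊂ {p = []}          {[]}          _   p≢q = contradiction refl p≢q
⊆∧≢⇒⊂ {p = inside ∷ p}  {inside ∷ q}  p⊆q p≢q = s⊂s (⊆∧≢⇒⊂ (drop-∷-⊆ p⊆q) (p≢q ∘ cong (inside ∷_)))
⊆∧≢⇒⊂ {p = inside ∷ p}  {outside ∷ q} p⊆q _   = contradiction (p⊆q Data.Vec.here) λ ()
⊆∧≢⇒⊂ {p = outside ∷ p} {inside ∷ q}  p⊆q _   = out⊂in (drop-∷-⊆ p⊆q)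
⊆∧≢⇒⊂ {p = outside ∷ p} {outside ∷ q} p⊆q p≢q = s⊂s (⊆∧≢⇒⊂ (drop-∷-⊆ p⊆q) (p≢q ∘ cong (outside ∷_)))

∣p∣≡∣q∣⇒p⊄q : {p q : Subset n} → ∣ p ∣ ≡ ∣ q ∣ → ¬ (p ⊂ q)
∣p∣≡∣q∣⇒p⊄q eq p⊂q = <-irrefl eq (p⊂q⇒∣p∣<∣q∣ p⊂q)

antichain-incomparable : {φ : Fin k → Subset n} → IsAntichainCopy φ →
                         ∀ {i j} → i ≢ j → ¬ (φ i ⊆ φ j ⊎ φ j ⊆ φ i)
antichain-incomparable (inj , anti) i≢j (inj₁ φi⊆φj) = anti _ _ (⊆∧≢⇒⊂ φi⊆φj (i≢j ∘ inj))
antichain-incomparable (inj , anti) i≢j (inj₂ φj⊆φi) = anti _ _ (⊆∧≢⇒⊂ φj⊆φi (i≢j ∘ sym ∘ inj))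

bounded-pigeonhole : (f : Fin (suc k) → ℕ) → (∀ i → f i < k) → ∃₂ λ i j → i ≢ j × f i ≡ f j
bounded-pigeonhole f f< with i , j , i<j , eq ← Fin.pigeonhole (n<1+n _) (λ i → fromℕ< (f< i)) =
  i , j , Fin.<⇒≢ i<j ,
  trans (sym (Fin.toℕ-fromℕ< (f< i))) (trans (cong toℕ eq) (Fin.toℕ-fromℕ< (f< j)))

%∧/⇒≡ : ∀ {a b} d .{{_ : NonZero d}} → a % d ≡ b % d → a / d ≡ b / d → a ≡ b
%∧/⇒≡ {a} {b} d %-eq /-eq = begin
  a                   ≡⟨ m≡m%n+[m/n]*n a d ⟩
  a % d + a / d * d   ≡⟨ cong₂ (λ r q → r + q * d) %-eq /-eq ⟩
  b % d + b / d * d   ≡⟨ m≡m%n+[m/n]*n b d ⟨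
  b                   ∎
  where open ≡-Reasoning

distinct-members : ∀ {A : Set} k {xs : List A} → Unique xs → k ≤ length xs →
                   Σ (Fin k → A) λ φ → Injective _≡_ _≡_ φ × (∀ i → φ i ∈ xs)
distinct-members zero    _        _       = (λ ()) , (λ {i} → contradiction i λ ()) , (λ ())
distinct-members (suc k) {x ∷ xs} (x∉xs ∷ unique) (s≤s k≤) with φ , φ-inj , φ∈ ← distinct-members k unique k≤ =
  x ∷ᶠ φ , inj , member
  where
  inj : Injective _≡_ _≡_ (x ∷ᶠ φ)
  inj {fzero}  {fzero}  _  = refl
  inj {fzero}  {fsuc j} eq = contradiction eq (All.lookup x∉xs (φ∈ j))
  inj {fsuc i} {fzero}  eq = contradiction (sym eq) (All.lookup x∉xs (φ∈ i))
  inj {fsuc i} {fsuc j} eq = cong fsuc (φ-inj eq)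
  member : ∀ i → (x ∷ᶠ φ) i ∈ (x ∷ xs)
  member fzero    = here refl
  member (fsuc i) = there (φ∈ i)

length-filter-split : ∀ {A : Set} {P : A → Set} (P? : ∀ y → Dec (P y)) (xs : List A) →
                      length (filter P? xs) + length (filter (¬? ∘ P?) xs) ≡ length xs
length-filter-split P? [] = refl
length-filter-split P? (x ∷ xs) with P? x
... | yes _ = cong suc (length-filter-split P? xs)
... | no  _ = trans (+-suc _ _) (cong suc (length-filter-split P? xs))

module _ {A : Set} (colour : A → ℕ) where

  Monochromatic : ℕ → List A → Set
  Monochromatic k xs = Σ (Fin k → A) λ φ →
    Injective _≡_ _≡_ φ × (∀ i → φ i ∈ xs) × (∀ i j → colour (φ i) ≡ colour (φ j))

  Rainbow : ℕ → List A → Set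
  Rainbow k xs = Σ (Fin k → A) λ φ →
    (∀ i → φ i ∈ xs) × (∀ i j → i ≢ j → colour (φ i) ≢ colour (φ j))

  private
    sameColour : (x y : A) → Dec (colour y ≡ colour x)
    sameColour x y = colour y ≟ colour x

    otherColour : (x y : A) → Dec (colour y ≢ colour x)
    otherColour x = ¬? ∘ sameColour x

    colourClass-monochromatic : ∀ k x {xs} → Unique xs → k ≤ length (filter (sameColour x) xs) →
                                Monochromatic k xs
    colourClass-monochromatic k x {xs} unique k≤
      with φ , φ-inj , φ∈ ← distinct-members k (Unique.filter⁺ (sameColour x) unique) k≤ =
      φ , φ-inj , (proj₁ ∘ filtered) , λ i j → trans (proj₂ (filtered i)) (sym (proj₂ (filtered j)))
      where
      filtered : ∀ i → φ i ∈ xs × colour (φ i) ≡ colour x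
      filtered i = ∈-filter⁻ (sameColour x) (φ∈ i)

    extend-monochromatic : ∀ {k} x xs → Monochromatic k (filter (otherColour x) (x ∷ xs)) →
                           Monochromatic k (x ∷ xs)
    extend-monochromatic x xs (φ , φ-inj , φ∈ , same) =
      φ , φ-inj , (proj₁ ∘ ∈-filter⁻ (otherColour x) ∘ φ∈) , same

    extend-rainbow : ∀ {k} x xs → Rainbow k (filter (otherColour x) (x ∷ xs)) →
                     Rainbow (suc k) (x ∷ xs)
    extend-rainbow x xs (ψ , ψ∈ , distinct) = x ∷ᶠ ψ , member , distinct′
      where
      otherColoured : ∀ i → ψ i ∈ (x ∷ xs) × colour (ψ i) ≢ colour x
      otherColoured i = ∈-filter⁻ (otherColour x) (ψ∈ i)
      member : ∀ i → (x ∷ᶠ ψ) i ∈ (x ∷ xs)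
      member fzero    = here refl
      member (fsuc i) = proj₁ (otherColoured i)
      distinct′ : ∀ i j → i ≢ j → colour ((x ∷ᶠ ψ) i) ≢ colour ((x ∷ᶠ ψ) j)
      distinct′ fzero    fzero    i≢j = contradiction refl i≢j
      distinct′ fzero    (fsuc j) _   = proj₂ (otherColoured j) ∘ sym
      distinct′ (fsuc i) fzero    _   = proj₂ (otherColoured i)
      distinct′ (fsuc i) (fsuc j) i≢j = distinct i j (i≢j ∘ cong fsuc)

  -- Remove the colour class of the first element: if it is small, at least
  -- a * b elements of other colours remain, and the first element extends a
  -- rainbow among them.
  monochromatic⊎rainbow : ∀ a b {xs} → Unique xs → a * b < length xs →
                          Monochromatic (suc a) xs ⊎ Rainbow (suc b) xs
  monochromatic⊎rainbow a b {[]} _ ab<0 = contradiction ab<0 n≮0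
  monochromatic⊎rainbow a zero {x ∷ xs} _ _ =
    inj₂ ((λ _ → x) , (λ _ → here refl) , λ { fzero fzero 0≢0 → contradiction refl 0≢0 })
  monochromatic⊎rainbow a (suc b) {x ∷ xs} unique ab< with suc a ≤? length (filter (sameColour x) (x ∷ xs))
  ... | yes many = inj₁ (colourClass-monochromatic (suc a) x unique many)
  ... | no  few  =
    [ inj₁ ∘ extend-monochromatic x xs , inj₂ ∘ extend-rainbow x xs ]′
      (monochromatic⊎rainbow a b (Unique.filter⁺ (otherColour x) unique) rest-large)
    where
    rest-large : a * b < length (filter (otherColour x) (x ∷ xs))
    rest-large = +-cancelˡ-< a (a * b) _ (begin-strict
      a + a * b                     ≡⟨ *-suc a b ⟨
      a * suc b                     <⟨ ab< ⟩
      length (x ∷ xs)               ≡⟨ length-filter-split (sameColour x) (x ∷ xs) ⟨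
      length (filter (sameColour x) (x ∷ xs)) + length (filter (otherColour x) (x ∷ xs))
                                    ≤⟨ +-monoˡ-≤ _ (≤-pred (≰⇒> few)) ⟩
      a + length (filter (otherColour x) (x ∷ xs)) ∎)
      where open ≤-Reasoning

layer : (n k : ℕ) → List (Subset n)
layer zero    zero    = [] ∷ []
layer zero    (suc k) = []
layer (suc n) zero    = map (outside ∷_) (layer n zero)
layer (suc n) (suc k) = map (inside ∷_) (layer n k) ++ map (outside ∷_) (layer n (suc k))

length-layer : ∀ n k → length (layer n k) ≡ n C k
length-layer zero    zero    = refl
length-layer zero    (suc k) = refl
length-layer (suc n) zero    = trans (length-map _ (layer n zero)) (length-layer n zero)
length-layer (suc n) (suc k) = begin
  length (map (inside ∷_) (layer n k) ++ map (outside ∷_) (layer n (suc k)))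
    ≡⟨ length-++ (map (inside ∷_) (layer n k)) ⟩
  length (map (inside ∷_) (layer n k)) + length (map (outside ∷_) (layer n (suc k)))
    ≡⟨ cong₂ _+_ (length-map _ (layer n k)) (length-map _ (layer n (suc k))) ⟩
  length (layer n k) + length (layer n (suc k))
    ≡⟨ cong₂ _+_ (length-layer n k) (length-layer n (suc k)) ⟩
  n C k + n C suc k
    ≡⟨ nCk+nC[k+1]≡[n+1]C[k+1] n k ⟩
  suc n C suc k ∎
  where open ≡-Reasoning

∈-layer⁻ : ∀ n k {s} → s ∈ layer n k → ∣ s ∣ ≡ k
∈-layer⁻ zero zero (here refl) = refl
∈-layer⁻ (suc n) zero s∈ with _ , t∈ , refl ← ∈-map⁻ (outside ∷_) s∈ = ∈-layer⁻ n zero t∈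
∈-layer⁻ (suc n) (suc k) s∈ with ∈-++⁻ (map (inside ∷_) (layer n k)) s∈
... | inj₁ s∈ˡ with _ , t∈ , refl ← ∈-map⁻ (inside ∷_) s∈ˡ = cong suc (∈-layer⁻ n k t∈)
... | inj₂ s∈ʳ with _ , t∈ , refl ← ∈-map⁻ (outside ∷_) s∈ʳ = ∈-layer⁻ n (suc k) t∈

∈-layer⁺ : (s : Subset n) → ∣ s ∣ ≡ k → s ∈ layer n k
∈-layer⁺ {k = zero}  []            _  = here refl
∈-layer⁺ {k = suc k} (inside ∷ s)  eq = ∈-++⁺ˡ (∈-map⁺ (inside ∷_) (∈-layer⁺ s (suc-injective eq)))
∈-layer⁺ {k = zero}  (outside ∷ s) eq = ∈-map⁺ (outside ∷_) (∈-layer⁺ s eq)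
∈-layer⁺ {suc n} {suc k} (outside ∷ s) eq =
  ∈-++⁺ʳ (map (inside ∷_) (layer n k)) (∈-map⁺ (outside ∷_) (∈-layer⁺ s eq))

layer-unique : ∀ n k → Unique (layer n k)
layer-unique zero    zero    = [] ∷ []
layer-unique zero    (suc k) = []
layer-unique (suc n) zero    = Unique.map⁺ ∷-injectiveʳ (layer-unique n zero)
layer-unique (suc n) (suc k) =
  Unique.++⁺ (Unique.map⁺ ∷-injectiveʳ (layer-unique n k))
             (Unique.map⁺ ∷-injectiveʳ (layer-unique n (suc k))) disjoint
  where
  disjoint : ∀ {s} → ¬ (s ∈ map (inside ∷_) (layer n k) × s ∈ map (outside ∷_) (layer n (suc k)))
  disjoint (s∈ˡ , s∈ʳ) with ∈-map⁻ (inside ∷_) s∈ˡ | ∈-map⁻ (outside ∷_) s∈ʳ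
  ... | _ , _ , refl | _ , _ , ()

layer-⊄ : ∀ {N k m} {φ : Fin m → Subset N} → (∀ i → φ i ∈ layer N k) → ∀ i j → ¬ (φ i ⊂ φ j)
layer-⊄ {N} {k} φ∈ i j = ∣p∣≡∣q∣⇒p⊄q (trans (∈-layer⁻ N k (φ∈ i)) (sym (∈-layer⁻ N k (φ∈ j))))

layer-arrows : ∀ a b N k → a * b < N C k → ArrowsAA (suc a) (suc b) N
layer-arrows a b N k ab< colour
  with monochromatic⊎rainbow colour a b (layer-unique N k) (subst (a * b <_) (sym (length-layer N k)) ab<)
... | inj₁ (φ , φ-inj , φ∈ , same) = inj₁ (φ , (φ-inj , layer-⊄ φ∈) , same)
... | inj₂ (ψ , ψ∈ , distinct) = inj₂ (ψ , (ψ-inj , layer-⊄ ψ∈) , distinct)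
  where
  ψ-inj : Injective _≡_ _≡_ ψ
  ψ-inj {i} {j} eq with i Fin.≟ j
  ... | yes i≡j = i≡j
  ... | no  i≢j = contradiction (cong colour eq) (distinct i j i≢j)

-- A chain is described by its skeleton: a position is either matched (with a
-- fixed value, off or on) or free.  The j-th set of the chain puts the first j
-- free positions inside and the remaining free positions outside.
data Slot : Set where
  off on free : Slot

setFirstFree : Vec Slot n → Vec Slot n
setFirstFree []         = []
setFirstFree (off ∷ t)  = off ∷ setFirstFree t
setFirstFree (on ∷ t)   = on ∷ setFirstFree t
setFirstFree (free ∷ t) = on ∷ t

#on #free : Vec Slot n → ℕ
#on []         = 0
#on (off ∷ t)  = #on t
#on (on ∷ t)   = suc (#on t)
#on (free ∷ t) = #on t
#free []         = 0
#free (off ∷ t)  = #free t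
#free (on ∷ t)   = #free t
#free (free ∷ t) = suc (#free t)

chain : Vec Slot n → ℕ → Subset n
chain []         j       = []
chain (off ∷ t)  j       = outside ∷ chain t j
chain (on ∷ t)   j       = inside ∷ chain t j
chain (free ∷ t) zero    = outside ∷ chain t zero
chain (free ∷ t) (suc j) = inside ∷ chain t j

-- The number of unmatched inside positions of s, i.e. the index of s on its chain.
height : Subset n → ℕ
height []            = 0
height (inside ∷ s)  = suc (height s)
height (outside ∷ s) = pred (height s)

-- An outside position is matched with the first free position to its right
-- that is inside, if there is one (brackets: outside = "(", inside = ")").
prependOutside : ℕ → Vec Slot n → Vec Slot (suc n)
prependOutside zero    t = free ∷ t
prependOutside (suc _) t = off ∷ setFirstFree t

skeleton : Subset n → Vec Slot n
skeleton []            = []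
skeleton (inside ∷ s)  = free ∷ skeleton s
skeleton (outside ∷ s) = prependOutside (height s) (skeleton s)

chain-setFirstFree : (t : Vec Slot n) → ∀ j → chain (setFirstFree t) j ≡ chain t (suc j)
chain-setFirstFree []         j = refl
chain-setFirstFree (off ∷ t)  j = cong (outside ∷_) (chain-setFirstFree t j)
chain-setFirstFree (on ∷ t)   j = cong (inside ∷_) (chain-setFirstFree t j)
chain-setFirstFree (free ∷ t) j = refl

suc-#free-setFirstFree : (t : Vec Slot n) → 0 < #free t → suc (#free (setFirstFree t)) ≡ #free t
suc-#free-setFirstFree (off ∷ t)  pos = suc-#free-setFirstFree t pos
suc-#free-setFirstFree (on ∷ t)   pos = suc-#free-setFirstFree t pos
suc-#free-setFirstFree (free ∷ t) pos = refl

#on-setFirstFree : (t : Vec Slot n) → 0 < #free t → #on (setFirstFree t) ≡ suc (#on t)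
#on-setFirstFree (off ∷ t)  pos = #on-setFirstFree t pos
#on-setFirstFree (on ∷ t)   pos = cong suc (#on-setFirstFree t pos)
#on-setFirstFree (free ∷ t) pos = refl

chain-prependOutside : ∀ a (t : Vec Slot n) → chain (prependOutside a t) (pred a) ≡ outside ∷ chain t a
chain-prependOutside zero    t = refl
chain-prependOutside (suc a) t = cong (outside ∷_) (chain-setFirstFree t a)

chain-height : (s : Subset n) → chain (skeleton s) (height s) ≡ s
chain-height []            = refl
chain-height (inside ∷ s)  = cong (inside ∷_) (chain-height s)
chain-height (outside ∷ s) =
  trans (chain-prependOutside (height s) (skeleton s)) (cong (outside ∷_) (chain-height s))

height≤#free : (s : Subset n) → height s ≤ #free (skeleton s)
height≤#free []            = z≤n
height≤#free (inside ∷ s)  = s≤s (height≤#free s)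
height≤#free (outside ∷ s) = pred≤#free (height s) (height≤#free s)
  where
  pred≤#free : ∀ a {t : Vec Slot n} → a ≤ #free t → pred a ≤ #free (prependOutside a t)
  pred≤#free zero    _  = z≤n
  pred≤#free (suc a) {t} a<#free =
    ≤-pred (subst (suc a ≤_) (sym (suc-#free-setFirstFree t (≤-trans (s≤s z≤n) a<#free))) a<#free)

chain-mono : (t : Vec Slot n) → ∀ {i j} → i ≤ j → chain t i ⊆ chain t j
chain-mono []         _                  = ⊆-refl
chain-mono (off ∷ t)  i≤j                = s⊆s (chain-mono t i≤j)
chain-mono (on ∷ t)   i≤j                = s⊆s (chain-mono t i≤j)
chain-mono (free ∷ t) {zero}  {zero}  _  = s⊆s (chain-mono t z≤n)
chain-mono (free ∷ t) {zero}  {suc j} _  = out⊆ (chain-mono t z≤n)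
chain-mono (free ∷ t) {suc i} {suc j} i≤j = s⊆s (chain-mono t (≤-pred i≤j))

∣chain∣ : (t : Vec Slot n) → ∀ j → j ≤ #free t → ∣ chain t j ∣ ≡ #on t + j
∣chain∣ []         zero    _   = refl
∣chain∣ (off ∷ t)  j       j≤  = ∣chain∣ t j j≤
∣chain∣ (on ∷ t)   j       j≤  = cong suc (∣chain∣ t j j≤)
∣chain∣ (free ∷ t) zero    _   = ∣chain∣ t zero z≤n
∣chain∣ (free ∷ t) (suc j) j≤  = trans (cong suc (∣chain∣ t j (≤-pred j≤))) (sym (+-suc (#on t) j))

-- The chain through s runs from size #on to size #on + #free: it is symmetric
-- about n / 2.
skeleton-symmetric : (s : Subset n) → #on (skeleton s) * 2 + #free (skeleton s) ≡ n
skeleton-symmetric []            = refl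
skeleton-symmetric (inside ∷ s)  = trans (+-suc _ _) (cong suc (skeleton-symmetric s))
skeleton-symmetric (outside ∷ s) =
  prependOutside-symmetric (height s) (height≤#free s) (skeleton-symmetric s)
  where
  prependOutside-symmetric : ∀ a {t : Vec Slot n} → a ≤ #free t → #on t * 2 + #free t ≡ n →
                             #on (prependOutside a t) * 2 + #free (prependOutside a t) ≡ suc n
  prependOutside-symmetric zero    _ eq = trans (+-suc _ _) (cong suc eq)
  prependOutside-symmetric {n} (suc a) {t} a<#free eq = begin
    #on (setFirstFree t) * 2 + #free (setFirstFree t)
      ≡⟨ cong (λ o → o * 2 + #free (setFirstFree t)) (#on-setFirstFree t pos) ⟩
    suc (suc (#on t * 2 + #free (setFirstFree t)))
      ≡⟨ cong suc (+-suc (#on t * 2) _) ⟨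
    suc (#on t * 2 + suc (#free (setFirstFree t)))
      ≡⟨ cong (λ f → suc (#on t * 2 + f)) (suc-#free-setFirstFree t pos) ⟩
    suc (#on t * 2 + #free t)
      ≡⟨ cong suc eq ⟩
    suc n ∎
    where
    open ≡-Reasoning
    pos : 0 < #free t
    pos = ≤-trans (s≤s z≤n) a<#free

ChainCoordinates : Vec Slot n → ℕ → Set
ChainCoordinates t j = skeleton (chain t j) ≡ t × height (chain t j) ≡ j

coordinates-outside : {t : Vec Slot n} → ∀ {j} → ChainCoordinates t j →
                      skeleton (outside ∷ chain t j) ≡ prependOutside j t × height (outside ∷ chain t j) ≡ pred j
coordinates-outside (skeleton-eq , height-eq) = cong₂ prependOutside height-eq skeleton-eq , cong pred height-eq

coordinates-free : {t : Vec Slot n} → (∀ j → j ≤ #free t → ChainCoordinates t j) →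
                   ∀ j → j ≤ suc (#free t) → ChainCoordinates (free ∷ t) j
coordinates-free coordinates zero    _  = coordinates-outside (coordinates zero z≤n)
coordinates-free coordinates (suc j) j≤ with skeleton-eq , height-eq ← coordinates j (≤-pred j≤) =
  cong (free ∷_) skeleton-eq , cong suc height-eq

coordinates-prependOutside : ∀ a {t : Vec Slot n} → a ≤ #free t → (∀ j → j ≤ #free t → ChainCoordinates t j) →
                             ∀ j → j ≤ #free (prependOutside a t) → ChainCoordinates (prependOutside a t) j
coordinates-prependOutside zero    _ coordinates = coordinates-free coordinates
coordinates-prependOutside (suc a) {t} a<#free coordinates j j≤ =
  subst (λ u → skeleton (outside ∷ u) ≡ off ∷ setFirstFree t × height (outside ∷ u) ≡ j)
        (sym (chain-setFirstFree t j))
        (coordinates-outside (coordinates (suc j) j<#free))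
  where
  j<#free : suc j ≤ #free t
  j<#free = subst (suc j ≤_) (suc-#free-setFirstFree t (≤-trans (s≤s z≤n) a<#free)) (s≤s j≤)

chain-coordinates : (s : Subset n) → ∀ j → j ≤ #free (skeleton s) → ChainCoordinates (skeleton s) j
chain-coordinates []            zero _ = refl , refl
chain-coordinates (inside ∷ s)  = coordinates-free (chain-coordinates s)
chain-coordinates (outside ∷ s) =
  coordinates-prependOutside (height s) (height≤#free s) (chain-coordinates s)

chain-comparable : (t : Vec Slot n) → ∀ i j → chain t i ⊆ chain t j ⊎ chain t j ⊆ chain t i
chain-comparable t i j = Data.Sum.map (chain-mono t) (chain-mono t) (≤-total i j)

sameSkeleton⇒comparable : {s t : Subset n} → skeleton s ≡ skeleton t → s ⊆ t ⊎ t ⊆ s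
sameSkeleton⇒comparable {s = s} {t} eq =
  subst₂ (λ u v → u ⊆ v ⊎ v ⊆ u) (chain-height s) t-on-chain
         (chain-comparable (skeleton s) (height s) (height t))
  where
  t-on-chain : chain (skeleton s) (height t) ≡ t
  t-on-chain = trans (cong (λ u → chain u (height t)) eq) (chain-height t)

middle : Subset n → Subset n
middle s = chain (skeleton s) (#free (skeleton s) / 2)

∣middle∣ : (s : Subset n) → ∣ middle s ∣ ≡ n / 2
∣middle∣ {n} s = begin
  ∣ middle s ∣                 ≡⟨ ∣chain∣ t _ (m/n≤m (#free t) 2) ⟩
  #on t + #free t / 2          ≡⟨ cong (_+ #free t / 2) (m*n/n≡m (#on t) 2) ⟨
  #on t * 2 / 2 + #free t / 2  ≡⟨ +-distrib-/-∣ˡ (#free t) (n∣m*n (#on t)) ⟨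
  (#on t * 2 + #free t) / 2    ≡⟨ cong (_/ 2) (skeleton-symmetric s) ⟩
  n / 2                        ∎
  where
  open ≡-Reasoning
  t : Vec Slot n
  t = skeleton s

skeleton-middle : (s : Subset n) → skeleton (middle s) ≡ skeleton s
skeleton-middle s = proj₁ (chain-coordinates s _ (m/n≤m (#free (skeleton s)) 2))

ChainCover : ℕ → ℕ → Set
ChainCover N w = Σ (Subset N → ℕ) λ κ → (∀ s → κ s < w) × (∀ s t → κ s ≡ κ t → s ⊆ t ⊎ t ⊆ s)

-- Each chain meets the middle layer exactly once; label it by the position
-- of that meeting point in the middle layer.
symmetricChainCover : ∀ N → ChainCover N (N C (N / 2))
symmetricChainCover N = κ , κ< , comparable
  where
  middle∈layer : ∀ s → middle s ∈ layer N (N / 2)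
  middle∈layer s = ∈-layer⁺ (middle s) (∣middle∣ s)
  κ : Subset N → ℕ
  κ s = toℕ (index (middle∈layer s))
  κ< : ∀ s → κ s < N C (N / 2)
  κ< s = subst (κ s <_) (length-layer N (N / 2)) (Fin.toℕ<n _)
  comparable : ∀ s t → κ s ≡ κ t → s ⊆ t ⊎ t ⊆ s
  comparable s t eq = sameSkeleton⇒comparable (begin
    skeleton s           ≡⟨ skeleton-middle s ⟨
    skeleton (middle s)  ≡⟨ cong skeleton middle-eq ⟩
    skeleton (middle t)  ≡⟨ skeleton-middle t ⟩
    skeleton t           ∎)
    where
    open ≡-Reasoning
    middle-eq : middle s ≡ middle t
    middle-eq = trans (lookup-index (middle∈layer s))
                      (trans (cong (lookup (layer N (N / 2))) (Fin.toℕ-injective eq))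
                             (sym (lookup-index (middle∈layer t))))

chainCover⇒¬arrows : ∀ {N w} a b → ChainCover N w → w ≤ a * b → ¬ ArrowsAA (suc a) (suc b) N
chainCover⇒¬arrows zero b (κ , κ< , _) w≤0 _ = n≮0 (≤-trans (κ< ∅) w≤0)
chainCover⇒¬arrows {N} {w} (suc a) b (κ , κ< , comparable) w≤ arrows =
  [ no-monochromatic , no-rainbow ]′ (arrows colour)
  where
  colour : Subset N → ℕ
  colour s = κ s / suc a
  colour< : ∀ s → colour s < b
  colour< s = m<n*o⇒m/o<n (≤-trans (κ< s) (≤-trans w≤ (≤-reflexive (*-comm (suc a) b))))
  no-monochromatic : ¬ MonoA (suc (suc a)) colour
  no-monochromatic (φ , antichain , same)
    with i , j , i≢j , %-eq ← bounded-pigeonhole (λ i → κ (φ i) % suc a) (λ i → m%n<n (κ (φ i)) (suc a)) =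
    antichain-incomparable antichain i≢j (comparable (φ i) (φ j) (%∧/⇒≡ (suc a) %-eq (same i j)))
  no-rainbow : ¬ RainbowA (suc b) colour
  no-rainbow (ψ , _ , distinct) with i , j , i≢j , eq ← bounded-pigeonhole (colour ∘ ψ) (colour< ∘ ψ) =
    distinct i j i≢j eq

mainTheorem3 : (m n N : ℕ) → 1 ≤ m → 1 ≤ n → NmnIs m n N → RRAntichainsIs m n N
mainTheorem3 (suc a) (suc b) N _ _ (large , minimal) =
  layer-arrows a b N (N / 2) (subst (_≤ N C (N / 2)) (+-comm (a * b) 1) large) ,
  λ M M<N → chainCover⇒¬arrows a b (symmetricChainCover M) (small M (minimal M M<N))
  where
  small : ∀ M → ¬ (a * b + 1 ≤ M C (M / 2)) → M C (M / 2) ≤ a * b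
  small M ¬large = m<1+n⇒m≤n (subst (M C (M / 2) <_) (+-comm (a * b) 1) (≰⇒> ¬large))
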